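{- For odd positive $k$, let $F_k:\mathbb{N}\to\mathbb{N}$ be given by $F_k(n)=\frac{3n+k}{2}$ if $n$ is odd and $F_k(n)=\frac{n}{2}$ if $n$ is even. For every positive integer $L$ there exists an odd positive integer $k$ such that $F_k$ has more than $L$ distinct cycles.
   Context: A cycle of $F_k$ is a set $\{x,F_k(x),\dots,F_k^{p-1}(x)\}$ with $x\in\mathbb{N}$, $p\ge1$, $F_k^p(x)=x$. -}

module Defs where

open import Data.Nat using (ℕ; zero; suc; _+_; _*_; _<_; _≤_; _/_; _%_)
open import Data.Nat.Properties using ()
open import Data.Product using (Σ; ∃; _×_; _,_)
open import Data.Fin using (Fin)
open import Relation.Binary.PropositionalEquality using (_≡_; _≢_)
open import Relation.Nullary using (¬_)

Odd : ℕ → Set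
Odd n = n % 2 ≡ 1

-- F_k(n) = (3n+k)/2 if n odd, n/2 if n even (division exact in each case when k odd)
F : ℕ → ℕ → ℕ
F k n with n % 2
... | 0 = n / 2
... | _ = (3 * n + k) / 2

iter : (ℕ → ℕ) → ℕ → ℕ → ℕ
iter f zero x = x
iter f (suc i) x = f (iter f i x)

-- A cycle is given by data (x , p) with p ≥ 1 and F_k^p(x) = x;
-- the cycle itself is the set {x, F_k(x), ..., F_k^{p-1}(x)}.
IsCycleData : ℕ → ℕ × ℕ → Set
IsCycleData k (x , p) = (1 ≤ p) × (iter (F k) p x ≡ x)

InCycle : ℕ → ℕ × ℕ → ℕ → Set
InCycle k (x , p) z = ∃ λ i → (i < p) × (iter (F k) i x ≡ z)

SameCycle : ℕ → ℕ × ℕ → ℕ × ℕ → Set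
SameCycle k c d = ∀ z → (InCycle k c z → InCycle k d z) × (InCycle k d z → InCycle k c z)

MoreThanCycles : ℕ → ℕ → Set
MoreThanCycles k L =
  Σ (Fin (suc L) → ℕ × ℕ) λ c →
    (∀ i → IsCycleData k (c i)) ×
    (∀ i j → i ≢ j → ¬ SameCycle k (c i) (c j))

module Submission where

-- Put  D j = 2^(j+2) - 3  (an odd number).  If  x  is odd and
-- k = x · D j,  then  3x + k = 2^(j+2) · x,  so the odd step of F_k sends
-- x  to  2^(j+1) · x,  and j+1 halvings bring it back to  x.  Hence x lies
-- on a cycle of length j+2 whose only odd element is x itself.
--
-- Taking  K = D 0 · D 1 ⋯ D L  (odd), each cofactor  x_i = K / D i  is odd
-- and yields such a cycle of F_K.  The cycles are pairwise distinct: a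
-- common set would contain the odd point x_i, forcing x_i = x_j, hence
-- D i = D j and i = j.

open import Defs
open import Data.Nat using (ℕ; _≤_; zero; suc; _+_; _*_; _∸_; _^_; _<_; _%_; _/_; z≤n; s≤s; NonZero)
open import Data.Nat.Properties
open import Data.Nat.DivMod using (m*n%n≡0; m*n/n≡m; m%n<n; %-distribˡ-*; [m+kn]%n≡m%n)
open import Data.Nat.Divisibility using (_∣_; divides; ∣-refl; ∣-trans; m∣m*n; n∣m*n)
open import Data.Product using (Σ; ∃; _×_; _,_; proj₁; proj₂)
open import Data.Fin using (Fin; toℕ)
open import Data.Fin.Properties using (toℕ≤pred[n]; toℕ-injective)
open import Data.Sum using (inj₁; inj₂)
open import Relation.Binary using (tri<; tri≈; tri>)
open import Relation.Binary.PropositionalEquality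
open import Relation.Nullary using (¬_; contradiction)

double-not-odd : ∀ y → ¬ Odd (2 * y)
double-not-odd y odd =
  contradiction (trans (sym (m*n%n≡0 y 2)) (trans (cong (_% 2) (*-comm y 2)) odd)) λ ()

odd-* : ∀ a b → Odd a → Odd b → Odd (a * b)
odd-* a b a-odd b-odd =
  trans (%-distribˡ-* a b 2) (cong₂ (λ u v → (u * v) % 2) a-odd b-odd)

odd-factorˡ : ∀ a b → Odd (a * b) → Odd a
odd-factorˡ a b ab-odd =
  remainder-odd (a % 2) (m%n<n a 2) (trans (sym (%-distribˡ-* a b 2)) ab-odd)
  where
  remainder-odd : ∀ r → r < 2 → (r * (b % 2)) % 2 ≡ 1 → r ≡ 1
  remainder-odd zero          _               ()
  remainder-odd (suc zero)    _               _ = refl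
  remainder-odd (suc (suc _)) (s≤s (s≤s ())) _

odd-nonZero : ∀ x → Odd x → NonZero x
odd-nonZero (suc x) _ = _

odd-positive : ∀ x → Odd x → 1 ≤ x
odd-positive (suc x) _ = s≤s z≤n

iter-suc-first : ∀ (f : ℕ → ℕ) n x → iter f (suc n) x ≡ iter f n (f x)
iter-suc-first f zero    x = refl
iter-suc-first f (suc n) x = cong f (iter-suc-first f n x)

half-double : ∀ y → 2 * y / 2 ≡ y
half-double y = trans (cong (_/ 2) (*-comm 2 y)) (m*n/n≡m y 2)

F-double : ∀ k y → F k (2 * y) ≡ y
F-double k y with (2 * y) % 2 | trans (cong (_% 2) (*-comm 2 y)) (m*n%n≡0 y 2)
... | .0 | refl = half-double y

F-odd-step : ∀ k x y → Odd x → 3 * x + k ≡ 2 * y → F k x ≡ y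
F-odd-step k x y x-odd eq with x % 2 | x-odd
... | .1 | refl = trans (cong (_/ 2) eq) (half-double y)

iter-halve : ∀ k s y → iter (F k) s (2 ^ s * y) ≡ y
iter-halve k zero    y = +-identityʳ y
iter-halve k (suc s) y = begin
  iter (F k) (suc s) (2 ^ suc s * y)    ≡⟨ iter-suc-first (F k) s _ ⟩
  iter (F k) s (F k (2 * 2 ^ s * y))    ≡⟨ cong (λ v → iter (F k) s (F k v)) (*-assoc 2 (2 ^ s) y) ⟩
  iter (F k) s (F k (2 * (2 ^ s * y)))  ≡⟨ cong (iter (F k) s) (F-double k (2 ^ s * y)) ⟩
  iter (F k) s (2 ^ s * y)              ≡⟨ iter-halve k s y ⟩
  y                                     ∎
  where open ≡-Reasoning

module OddPointCycle (k x j : ℕ) (x-odd : Odd x) (balance : 3 * x + k ≡ 2 ^ (2 + j) * x) where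

  first-step : F k x ≡ 2 ^ (1 + j) * x
  first-step = F-odd-step k x _ x-odd (trans balance (*-assoc 2 (2 ^ (1 + j)) x))

  orbit : ∀ s r → s + r ≡ 1 + j → iter (F k) (suc s) x ≡ 2 ^ r * x
  orbit s r s+r≡1+j = begin
    iter (F k) (suc s) x               ≡⟨ iter-suc-first (F k) s x ⟩
    iter (F k) s (F k x)               ≡⟨ cong (iter (F k) s) first-step ⟩
    iter (F k) s (2 ^ (1 + j) * x)     ≡⟨ cong (λ e → iter (F k) s (2 ^ e * x)) (sym s+r≡1+j) ⟩
    iter (F k) s (2 ^ (s + r) * x)     ≡⟨ cong (iter (F k) s) (trans (cong (_* x) (^-distribˡ-+-* 2 s r)) (*-assoc (2 ^ s) (2 ^ r) x)) ⟩
    iter (F k) s (2 ^ s * (2 ^ r * x)) ≡⟨ iter-halve k s (2 ^ r * x) ⟩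
    2 ^ r * x                          ∎
    where open ≡-Reasoning

  is-cycle : IsCycleData k (x , 2 + j)
  is-cycle = s≤s z≤n , trans (orbit (1 + j) 0 (+-identityʳ (1 + j))) (+-identityʳ x)

  unique-odd : ∀ z → InCycle k (x , 2 + j) z → Odd z → z ≡ x
  unique-odd z (zero  , _             , x≡z) _     = sym x≡z
  unique-odd z (suc s , s≤s (s≤s s≤j) , it≡z) z-odd with m≤n⇒∃[o]m+o≡n s≤j
  ... | r , s+r≡j = contradiction (subst Odd even-form z-odd) (double-not-odd (2 ^ r * x))
    where
    even-form : z ≡ 2 * (2 ^ r * x)
    even-form = trans (sym it≡z)
      (trans (orbit s (suc r) (trans (+-suc s r) (cong suc s+r≡j))) (*-assoc 2 (2 ^ r) x))

-- D j = 2^(j+2) - 3, written so that its oddness is visible.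
D : ℕ → ℕ
D j = 1 + 4 * (2 ^ j ∸ 1)

D-odd : ∀ j → Odd (D j)
D-odd j = trans (cong (λ v → (1 + v) % 2) (*-assoc 2 2 (2 ^ j ∸ 1)))
  (trans (cong (λ v → (1 + v) % 2) (*-comm 2 (2 * (2 ^ j ∸ 1))))
         ([m+kn]%n≡m%n 1 (2 * (2 ^ j ∸ 1)) 2))

three-plus-D : ∀ j → 3 + D j ≡ 2 ^ (2 + j)
three-plus-D j = begin
  4 + 4 * (2 ^ j ∸ 1)   ≡⟨ sym (*-distribˡ-+ 4 1 (2 ^ j ∸ 1)) ⟩
  4 * (1 + (2 ^ j ∸ 1)) ≡⟨ cong (4 *_) (m+[n∸m]≡n (m^n>0 2 j)) ⟩
  4 * 2 ^ j             ≡⟨ *-assoc 2 2 (2 ^ j) ⟩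
  2 ^ (2 + j)           ∎
  where open ≡-Reasoning

pow2-injective : ∀ m n → 2 ^ m ≡ 2 ^ n → m ≡ n
pow2-injective m n eq with <-cmp m n
... | tri< m<n _ _ = contradiction eq (<⇒≢ (^-monoʳ-< 2 (s≤s (s≤s z≤n)) m<n))
... | tri≈ _ m≡n _ = m≡n
... | tri> _ _ n<m = contradiction (sym eq) (<⇒≢ (^-monoʳ-< 2 (s≤s (s≤s z≤n)) n<m))

D-injective : ∀ i j → D i ≡ D j → i ≡ j
D-injective i j eq = suc-injective (suc-injective
  (pow2-injective (2 + i) (2 + j) (trans (sym (three-plus-D i)) (trans (cong (3 +_) eq) (three-plus-D j)))))

balance-of-multiple : ∀ k x j → k ≡ x * D j → 3 * x + k ≡ 2 ^ (2 + j) * x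
balance-of-multiple k x j k≡xD = begin
  3 * x + k         ≡⟨ cong (3 * x +_) (trans k≡xD (*-comm x (D j))) ⟩
  3 * x + D j * x   ≡⟨ sym (*-distribʳ-+ x 3 (D j)) ⟩
  (3 + D j) * x     ≡⟨ cong (_* x) (three-plus-D j) ⟩
  2 ^ (2 + j) * x   ∎
  where open ≡-Reasoning

K : ℕ → ℕ
K zero    = D 0
K (suc n) = D (suc n) * K n

K-odd : ∀ n → Odd (K n)
K-odd zero    = D-odd 0
K-odd (suc n) = odd-* (D (suc n)) (K n) (D-odd (suc n)) (K-odd n)

D∣K : ∀ n j → j ≤ n → D j ∣ K n
D∣K zero    .zero z≤n = ∣-refl
D∣K (suc n) j j≤1+n with m≤n⇒m<n∨m≡n j≤1+n
... | inj₁ (s≤s j≤n) = ∣-trans (D∣K n j j≤n) (n∣m*n (D (suc n)))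
... | inj₂ refl      = m∣m*n (K n)

distinct-cycles : ∀ k x y i j → Odd x → Odd y → k ≡ x * D i → k ≡ y * D j →
                  i ≢ j → ¬ SameCycle k (x , 2 + i) (y , 2 + j)
distinct-cycles k x y i j x-odd y-odd k≡xD k≡yD i≢j same = i≢j (D-injective i j D-equal)
  where
  open OddPointCycle k y j y-odd (balance-of-multiple k y j k≡yD)
  x≡y : x ≡ y
  x≡y = unique-odd x (proj₁ (same x) (0 , s≤s z≤n , refl)) x-odd
  D-equal : D i ≡ D j
  D-equal = *-cancelˡ-≡ (D i) (D j) x {{odd-nonZero x x-odd}}
    (trans (sym k≡xD) (trans k≡yD (cong (_* D j) (sym x≡y))))

module Cofactor (L : ℕ) (i : Fin (suc L)) where

  cofactor-spec : Σ ℕ λ q → K L ≡ q * D (toℕ i)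
  cofactor-spec with D∣K L (toℕ i) (toℕ≤pred[n] i)
  ... | divides q eq = q , eq

  cofactor : ℕ
  cofactor = proj₁ cofactor-spec

  K≡cofactor*D : K L ≡ cofactor * D (toℕ i)
  K≡cofactor*D = proj₂ cofactor-spec

  cofactor-odd : Odd cofactor
  cofactor-odd = odd-factorˡ cofactor (D (toℕ i)) (subst Odd K≡cofactor*D (K-odd L))

  cycle : ℕ × ℕ
  cycle = cofactor , 2 + toℕ i

  is-cycle : IsCycleData (K L) cycle
  is-cycle = OddPointCycle.is-cycle (K L) cofactor (toℕ i) cofactor-odd
               (balance-of-multiple (K L) cofactor (toℕ i) K≡cofactor*D)

theorem10 : ∀ (L : ℕ) → 1 ≤ L →
    ∃ λ k → Odd k × 1 ≤ k × MoreThanCycles k L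
theorem10 L _ =
  K L , K-odd L , odd-positive (K L) (K-odd L) , cycle , is-cycle , pairwise-distinct
  where
  open module C i = Cofactor L i using (cycle; is-cycle; cofactor; cofactor-odd; K≡cofactor*D)
  pairwise-distinct : ∀ i j → i ≢ j → ¬ SameCycle (K L) (cycle i) (cycle j)
  pairwise-distinct i j i≢j =
    distinct-cycles (K L) (cofactor i) (cofactor j) (toℕ i) (toℕ j)
      (cofactor-odd i) (cofactor-odd j) (K≡cofactor*D i) (K≡cofactor*D j)
      (λ eq → i≢j (toℕ-injective eq))
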